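{- Let $q$ be a prime power and let $n,d$ be integers with $d$ even and $2\le d\le n$. Then $$\chi_d(n,q)\ \ge\ \max\{q,\lfloor 2n/d\rfloor\}.$$
   Context: Let $V_n=\mathbb{F}_q^n$ be the set of all length-$n$ vectors over the finite field $\mathbb{F}_q$. The Hamming distance $d_H(\mathbf{x},\mathbf{y})$ between $\mathbf{x},\mathbf{y}\in V_n$ is the number of coordinates in which they differ. A coloring $\Gamma:V_n\to\{1,\dots,L\}$ is called an exactly $d$-distance coloring if $\Gamma(\mathbf{x})\neq\Gamma(\mathbf{y})$ for all $\mathbf{x},\mathbf{y}\in V_n$ with $d_H(\mathbf{x},\mathbf{y})= d$. $\chi_d(n,q)$ denotes the minimum number $L$ of colors for which an exactly $d$-distance coloring of $V_n$ exists. -}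

module Defs where

open import Data.Nat using (ℕ; zero; suc; _+_; _^_; _≤_)
open import Data.Nat.Primality using (Prime)
open import Data.Fin using (Fin; zero; suc; _≟_)
open import Data.Product using (Σ; _×_)
open import Relation.Binary.PropositionalEquality using (_≡_)
open import Relation.Nullary using (yes; no)

IsPrimePower : ℕ → Set
IsPrimePower q = Σ ℕ λ p → Σ ℕ λ k → Prime p × (1 ≤ k) × (q ≡ p ^ k)

-- V_n over an alphabet of size q (the underlying set of F_q is identified
-- with Fin q; Hamming distance and colorings only depend on this set)
Word : ℕ → ℕ → Set
Word q n = Fin n → Fin q

hamming : ∀ {q n} → Word q n → Word q n → ℕ
hamming {q} {zero} x y = 0
hamming {q} {suc n} x y with x zero ≟ y zero
... | yes _ = hamming {q} {n} (λ i → x (suc i)) (λ i → y (suc i))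
... | no _ = suc (hamming {q} {n} (λ i → x (suc i)) (λ i → y (suc i)))

IsExactDistColoring : ∀ {q n L} → ℕ → (Word q n → Fin L) → Set
IsExactDistColoring {q} {n} d Γ =
  (x y : Word q n) → hamming x y ≡ d → Γ x ≡ Γ y → Data.Empty.⊥
  where import Data.Empty

-- Two families of words pairwise at Hamming distance exactly d force distinct colours.
-- First, the q words a^d 0^(n-d), one for each letter a. Second, writing d = 2k, the
-- ⌊2n/d⌋ = ⌊n/k⌋ words that are 1 on the i-th block of k coordinates and 0 elsewhere:
-- two of them differ exactly on their two blocks.
module Submission where

open import Defs
open import Data.Nat using (ℕ; zero; suc; _+_; _*_; _^_; _≤_; _<_; _⊔_; NonZero; s≤s; z≤n)
open import Data.Nat.Properties
  using (+-assoc; +-comm; +-identityʳ; *-comm; ≤-trans; *-monoˡ-≤; ⊔-lub; ^-monoʳ-≤; *-identityʳ;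
         m≤n⇒∃[o]m+o≡n; m*n≢0⇒m≢0)
open import Data.Nat.DivMod using (_/_; m/n*n≤m; m*n/o*n≡m/o)
open import Data.Nat.Divisibility using (_∣_; divides)
open import Data.Nat.Primality using (prime⇒nonZero; prime⇒nonTrivial)
open import Data.Nat.Base using (nonTrivial⇒n>1)
open import Data.Fin as Fin using (Fin; zero; suc; toℕ; _≟_)
open import Data.Fin.Properties using (injective⇒≤; <-cmp; <⇒≢; toℕ<n)
open import Data.Product using (_,_)
open import Data.Empty using (⊥-elim)
open import Function.Base using (_∘_; const)
open import Function.Definitions using (Injective)
open import Relation.Binary.Definitions using (tri<; tri≈; tri>)
open import Relation.Nullary using (yes; no; ¬_)
open import Relation.Binary.PropositionalEquality

hamming-refl : ∀ {q n} (x : Word q n) → hamming x x ≡ 0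
hamming-refl {n = zero} x = refl
hamming-refl {n = suc _} x with x zero ≟ x zero
... | yes _ = hamming-refl (x ∘ suc)
... | no x₀≢x₀ = ⊥-elim (x₀≢x₀ refl)

hamming-cong : ∀ {q n} {x x′ y y′ : Word q n} → x ≗ x′ → y ≗ y′ → hamming x y ≡ hamming x′ y′
hamming-cong {n = zero} x≗x′ y≗y′ = refl
hamming-cong {n = suc _} {x} {x′} {y} {y′} x≗x′ y≗y′ with x zero ≟ y zero | x′ zero ≟ y′ zero
... | yes _ | yes _ = hamming-cong (x≗x′ ∘ suc) (y≗y′ ∘ suc)
... | no _  | no _  = cong suc (hamming-cong (x≗x′ ∘ suc) (y≗y′ ∘ suc))
... | yes x₀≡y₀ | no x₀′≢y₀′ = ⊥-elim (x₀′≢y₀′ (trans (sym (x≗x′ zero)) (trans x₀≡y₀ (y≗y′ zero))))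
... | no x₀≢y₀ | yes x₀′≡y₀′ = ⊥-elim (x₀≢y₀ (trans (x≗x′ zero) (trans x₀′≡y₀′ (sym (y≗y′ zero)))))

-- Words are built as prefixes of infinite sequences, so that their length is free.
Seq : ℕ → Set
Seq q = ℕ → Fin q

take : ∀ {q} n → Seq q → Word q n
take n f = f ∘ toℕ

prepend : ∀ {q} → ℕ → Fin q → Seq q → Seq q
prepend zero    a f i       = f i
prepend (suc k) a f zero    = a
prepend (suc k) a f (suc i) = prepend k a f i

prepend-const : ∀ {q} k (a : Fin q) → prepend k a (const a) ≗ const a
prepend-const zero    a i       = refl
prepend-const (suc k) a zero    = refl
prepend-const (suc k) a (suc i) = prepend-const k a i

hamming-prepend-≡ : ∀ {q} k n (a : Fin q) f g →
  hamming (take (k + n) (prepend k a f)) (take (k + n) (prepend k a g)) ≡ hamming (take n f) (take n g)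
hamming-prepend-≡ zero    n a f g = refl
hamming-prepend-≡ (suc k) n a f g with a ≟ a
... | yes _ = hamming-prepend-≡ k n a f g
... | no a≢a = ⊥-elim (a≢a refl)

hamming-prepend-≢ : ∀ {q} k n {a b : Fin q} f g → ¬ a ≡ b →
  hamming (take (k + n) (prepend k a f)) (take (k + n) (prepend k b g)) ≡ k + hamming (take n f) (take n g)
hamming-prepend-≢ zero    n f g a≢b = refl
hamming-prepend-≢ (suc k) n {a} {b} f g a≢b with a ≟ b
... | yes a≡b = ⊥-elim (a≢b a≡b)
... | no _ = cong suc (hamming-prepend-≢ k n f g a≢b)

IsDistanceClique : ∀ {q n s} → ℕ → (Fin s → Word q n) → Set
IsDistanceClique d c = ∀ i j → i Fin.< j → hamming (c i) (c j) ≡ d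

clique-size≤colours : ∀ {q n s L d} {Γ : Word q n → Fin L} {c : Fin s → Word q n} →
  IsExactDistColoring d Γ → IsDistanceClique d c → s ≤ L
clique-size≤colours {Γ = Γ} {c} proper clique = injective⇒≤ {f = Γ ∘ c} injective
  where
  injective : Injective _≡_ _≡_ (Γ ∘ c)
  injective {i} {j} Γcᵢ≡Γcⱼ with <-cmp i j
  ... | tri< i<j _ _ = ⊥-elim (proper _ _ (clique i j i<j) Γcᵢ≡Γcⱼ)
  ... | tri≈ _ i≡j _ = i≡j
  ... | tri> _ _ j<i = ⊥-elim (proper _ _ (clique j i j<i) (sym Γcᵢ≡Γcⱼ))

letter-clique : ∀ {q n d} (g : Seq q) → d ≤ n → IsDistanceClique d (λ a → take n (prepend d a g))
letter-clique {d = d} g d≤n a b a<b with m≤n⇒∃[o]m+o≡n d≤n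
... | r , refl = begin
  hamming (take (d + r) (prepend d a g)) (take (d + r) (prepend d b g)) ≡⟨ hamming-prepend-≢ d r g g (<⇒≢ a<b) ⟩
  d + hamming (take r g) (take r g)                                     ≡⟨ cong (d +_) (hamming-refl (take r g)) ⟩
  d + 0                                                                 ≡⟨ +-identityʳ d ⟩
  d                                                                     ∎
  where open ≡-Reasoning

module Blocks {q} {o e : Fin q} (o≢e : ¬ o ≡ e) (k : ℕ) where

  -- block i is e on the coordinates [i k, (i + 1) k) and o elsewhere.
  block : ℕ → Seq q
  block zero    = prepend k e (const o)
  block (suc i) = prepend k o (block i)

  hamming-const-unfold : ∀ n (g : Seq q) →
    hamming (take n (const o)) (take n g) ≡ hamming (take n (prepend k o (const o))) (take n g)
  hamming-const-unfold n g = hamming-cong {n = n} {y = take n g} (sym ∘ prepend-const k o ∘ toℕ) (λ _ → refl)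

  hamming-const-block : ∀ j r → hamming (take (j * k + (k + r)) (const o)) (take (j * k + (k + r)) (block j)) ≡ k
  hamming-const-block zero r = begin
    hamming (take (k + r) (const o)) (take (k + r) (block 0))
      ≡⟨ hamming-const-unfold (k + r) (block 0) ⟩
    hamming (take (k + r) (prepend k o (const o))) (take (k + r) (block 0))
      ≡⟨ hamming-prepend-≢ k r (const o) (const o) o≢e ⟩
    k + hamming (take r (const o)) (take r (const o))
      ≡⟨ cong (k +_) (hamming-refl (take r (const o))) ⟩
    k + 0
      ≡⟨ +-identityʳ k ⟩
    k ∎
    where open ≡-Reasoning
  hamming-const-block (suc j) r rewrite +-assoc k (j * k) (k + r) = begin
    hamming (take (k + n) (const o)) (take (k + n) (block (suc j)))
      ≡⟨ hamming-const-unfold (k + n) (block (suc j)) ⟩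
    hamming (take (k + n) (prepend k o (const o))) (take (k + n) (block (suc j)))
      ≡⟨ hamming-prepend-≡ k n o (const o) (block j) ⟩
    hamming (take n (const o)) (take n (block j))
      ≡⟨ hamming-const-block j r ⟩
    k ∎
    where
    open ≡-Reasoning
    n = j * k + (k + r)

  hamming-block : ∀ i j r → i < j → hamming (take (j * k + (k + r)) (block i)) (take (j * k + (k + r)) (block j)) ≡ k + k
  hamming-block zero (suc j) r _ rewrite +-assoc k (j * k) (k + r) = begin
    hamming (take (k + n) (prepend k e (const o))) (take (k + n) (prepend k o (block j)))
      ≡⟨ hamming-prepend-≢ k n (const o) (block j) (o≢e ∘ sym) ⟩
    k + hamming (take n (const o)) (take n (block j))
      ≡⟨ cong (k +_) (hamming-const-block j r) ⟩
    k + k ∎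
    where
    open ≡-Reasoning
    n = j * k + (k + r)
  hamming-block (suc i) (suc j) r (s≤s i<j) rewrite +-assoc k (j * k) (k + r) =
    trans (hamming-prepend-≡ k (j * k + (k + r)) o (block i) (block j)) (hamming-block i j r i<j)

  block-clique : ∀ {m n} → m * k ≤ n → IsDistanceClique (k + k) (λ (i : Fin m) → take n (block (toℕ i)))
  block-clique mk≤n i j i<j with m≤n⇒∃[o]m+o≡n (≤-trans (*-monoˡ-≤ k (toℕ<n j)) mk≤n)
  ... | r , refl rewrite +-comm k (toℕ j * k) | +-assoc (toℕ j * k) k r = hamming-block (toℕ i) (toℕ j) r i<j

primePower⇒2≤ : ∀ {q} → IsPrimePower q → 2 ≤ q
primePower⇒2≤ (p , k , p-prime , 1≤k , refl) = ≤-trans 2≤p p≤p^k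
  where
  2≤p : 2 ≤ p
  2≤p = nonTrivial⇒n>1 p {{prime⇒nonTrivial p-prime}}
  p≤p^k : p ≤ p ^ k
  p≤p^k = subst (_≤ p ^ k) (*-identityʳ p) (^-monoʳ-≤ p {{prime⇒nonZero p-prime}} 1≤k)

[2*m/n*2]*n≤m : ∀ m n .{{_ : NonZero (n * 2)}} → 2 * m / (n * 2) * n ≤ m
[2*m/n*2]*n≤m m n = subst (λ x → x * n ≤ m) (sym 2m/2n≡m/n) (m/n*n≤m m n)
  where
  instance
    n≢0 : NonZero n
    n≢0 = m*n≢0⇒m≢0 n
  2m/2n≡m/n : 2 * m / (n * 2) ≡ m / n
  2m/2n≡m/n = trans (cong (_/ (n * 2)) (*-comm 2 m)) (m*n/o*n≡m/o m 2 n)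

n*2≡n+n : ∀ n → n * 2 ≡ n + n
n*2≡n+n n = trans (*-comm n 2) (cong (n +_) (+-identityʳ n))

theorem3p2 : (q n d : ℕ) → IsPrimePower q → 2 ∣ d → 2 ≤ d → d ≤ n →
    .{{_ : NonZero d}} →
    (L : ℕ) → (Γ : Word q n → Fin L) → IsExactDistColoring d Γ →
    q ⊔ ((2 * n) / d) ≤ L
theorem3p2 q n d q-primePower (divides k refl) _ d≤n L Γ proper with primePower⇒2≤ q-primePower
... | s≤s (s≤s z≤n) = ⊔-lub
  (clique-size≤colours proper (letter-clique (const zero) d≤n))
  (clique-size≤colours (subst (λ d → IsExactDistColoring d Γ) (n*2≡n+n k) proper)
                       (Blocks.block-clique {o = zero} {e = suc zero} (λ ()) k {2 * n / (k * 2)} ([2*m/n*2]*n≤m n k)))
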